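{- For any integers $r$ and $\chi$ with $2\leq \chi\leq r+1$, there exists a Cayley graph that is $r$-regular and has chromatic number $\chi$.
   Context: Graphs are simple and finite. For a finite group $\Gamma$ and a generating set $X$ of $\Gamma$ with $X=X^{ -1}$ and $1_\Gamma\notin X$, the Cayley graph $Cay(\Gamma,X)$ has vertex set $\Gamma$, with $g,h$ adjacent iff $gx=h$ for some $x\in X$. -}

module Defs where

open import Level using (0ℓ)
open import Data.Nat using (ℕ)
open import Data.Fin using (Fin)
open import Data.Fin.Subset using (Subset; _∈_; _∉_)
open import Data.Product using (Σ; _×_)
open import Relation.Binary.PropositionalEquality using (_≡_; _≢_)
open import Relation.Nullary using (¬_)
open import Algebra.Structures using (IsGroup)
open import Function.Bundles using (_↔_)

-- A finite group: carrier is Fin order (every finite group is isomorphic to one of these),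
-- with equality being propositional equality.
record FiniteGroup : Set where
  field
    order   : ℕ
    _∙_     : Fin order → Fin order → Fin order
    ε       : Fin order
    _⁻¹     : Fin order → Fin order
    isGroup : IsGroup _≡_ _∙_ ε _⁻¹

module _ (Γ : FiniteGroup) where
  open FiniteGroup Γ

  -- The submonoid generated by X (equals the subgroup generated, as Γ is finite / X symmetric).
  data Generated (X : Subset order) : Fin order → Set where
    gen-ε : Generated X ε
    gen-∙ : ∀ {g x} → Generated X g → x ∈ X → Generated X (g ∙ x)

  record IsCayleySet (X : Subset order) : Set where
    field
      generates : ∀ g → Generated X g
      symmetric : ∀ x → x ∈ X → (x ⁻¹) ∈ X
      no-unit   : ε ∉ X

  CayAdj : Subset order → Fin order → Fin order → Set
  CayAdj X g h = Σ (Fin order) (λ x → x ∈ X × (g ∙ x) ≡ h)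

module _ {n : ℕ} (Adj : Fin n → Fin n → Set) where

  Neighbourhood : Fin n → Set
  Neighbourhood v = Σ (Fin n) (λ w → Adj v w)

  IsRegular : ℕ → Set
  IsRegular r = ∀ v → Neighbourhood v ↔ Fin r

  Colourable : ℕ → Set
  Colourable k = Σ (Fin n → Fin k) (λ c → ∀ v w → Adj v w → c v ≢ c w)

  HasChromaticNumber : ℕ → Set
  HasChromaticNumber χ = Colourable χ × (∀ k → k Data.Nat.< χ → ¬ Colourable k)

module Submission where

open import Defs
open import Data.Nat using (ℕ; _≤_; suc)
open import Data.Fin.Subset using (Subset)
open import Data.Product using (Σ; _×_)

open import Algebra.Bundles using (Group)
open import Algebra.Structures using (IsGroup)
import Algebra.Properties.Group as GroupProperties
open import Data.Bool using (Bool; true; false; T)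
open import Data.Bool.Properties using (T-irrelevant; T-≡)
open import Data.Fin as Fin using (Fin; toℕ; fromℕ<)
open import Data.Fin.Properties
  using (toℕ-injective; toℕ-fromℕ<; toℕ<n; pigeonhole; <⇒≢; *↔×) renaming (_≟_ to _≟ᶠ_)
open import Data.Fin.Subset using (_∈_)
open import Data.Nat using (zero; _+_; _*_; _∸_; _<_; s≤s)
open import Data.Nat.DivMod using (_%_; m%n<n; %-distribˡ-+; m%n%n≡m%n; m<n⇒m%n≡m; n%n≡0)
open import Data.Nat.Properties using (+-comm; +-assoc; +-identityʳ; <⇒≤; m+[n∸m]≡n; m∸n+n≡m; ≤-pred)
open import Data.Product using (_,_; proj₁; proj₂)
open import Data.Product.Function.Dependent.Propositional using (Σ-↔)
open import Data.Product.Function.NonDependent.Propositional using (_×-↔_)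
open import Data.Vec using (tabulate)
open import Data.Vec.Properties using ([]=⇒lookup; lookup⇒[]=; lookup∘tabulate)
open import Data.Vec.Properties.WithK using ([]=-irrelevant)
open import Function using (_∘_; id)
open import Function.Bundles using (_↔_; mk↔ₛ′; Inverse; Equivalence)
open import Function.Properties.Inverse using (↔-refl; ↔-sym; ↔-trans)
open import Relation.Binary.PropositionalEquality
open import Relation.Nullary using (¬_; Dec)
open import Relation.Nullary.Decidable using (⌊_⌋; toWitness; fromWitness; map′)

-- The complete graph K_χ is the Cayley graph Cay(ℤ_χ, ℤ_χ ∖ {0});
-- it is (χ-1)-regular and has chromatic number χ.  Given a Cayley graph
-- Cay(Γ, X), the group Γ × ℤ₂ with connection set (X × {0}) ∪ {(1_Γ, 1)} gives
-- the prism G □ K₂: its degree is one larger, and for χ ≥ 2 the chromatic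
-- number is unchanged (colour the second layer by the first colouring followed
-- by the fixed-point-free shift c ↦ c + 1 of ℤ_χ; the first layer alone
-- already needs χ colours).  Applying the prism r - χ + 1 times to K_χ yields
-- an r-regular Cayley graph of chromatic number χ.

isGroup-≡ : ∀ {A : Set} (_∙_ : A → A → A) (e : A) (inv : A → A) →
  (∀ x y z → (x ∙ y) ∙ z ≡ x ∙ (y ∙ z)) →
  (∀ x → e ∙ x ≡ x) → (∀ x → x ∙ e ≡ x) →
  (∀ x → inv x ∙ x ≡ e) → (∀ x → x ∙ inv x ≡ e) →
  IsGroup _≡_ _∙_ e inv
isGroup-≡ _∙_ e inv assoc idˡ idʳ invˡ invʳ = record
  { isMonoid = record
    { isSemigroup = record
      { isMagma = record { isEquivalence = isEquivalence ; ∙-cong = cong₂ _∙_ }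
      ; assoc = assoc }
    ; identity = idˡ , idʳ }
  ; inverse = invˡ , invʳ
  ; ⁻¹-cong = cong inv }

groupOf : ∀ {A : Set} {_∙_ : A → A → A} {e : A} {inv : A → A} →
  IsGroup _≡_ _∙_ e inv → Group _ _
groupOf isG = record { isGroup = isG }

×-isGroup : ∀ {A B : Set} {_∙_ : A → A → A} {e : A} {i : A → A}
  {_∘′_ : B → B → B} {e′ : B} {i′ : B → B} →
  IsGroup _≡_ _∙_ e i → IsGroup _≡_ _∘′_ e′ i′ →
  IsGroup _≡_ (λ (a , b) (c , d) → (a ∙ c , b ∘′ d)) (e , e′) (λ (a , b) → (i a , i′ b))
×-isGroup G H = isGroup-≡ _ _ _
  (λ (a , b) (c , d) (f , g) → cong₂ _,_ (G.assoc a c f) (H.assoc b d g))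
  (λ (a , b) → cong₂ _,_ (G.identityˡ a) (H.identityˡ b))
  (λ (a , b) → cong₂ _,_ (G.identityʳ a) (H.identityʳ b))
  (λ (a , b) → cong₂ _,_ (G.inverseˡ a) (H.inverseˡ b))
  (λ (a , b) → cong₂ _,_ (G.inverseʳ a) (H.inverseʳ b))
  where module G = IsGroup G
        module H = IsGroup H

transport-isGroup : ∀ {A B : Set} (φ : A ↔ B)
  {_∙_ : A → A → A} {e : A} {inv : A → A} → IsGroup _≡_ _∙_ e inv →
  let open Inverse φ in
  IsGroup _≡_ (λ x y → to (from x ∙ from y)) (to e) (λ x → to (inv (from x)))
transport-isGroup φ {_∙_} isG = isGroup-≡ _ _ _
  (λ x y z → cong to (trans (cong (_∙ from z) (back _))
                      (trans (assoc _ _ _) (cong (from x ∙_) (sym (back _))))))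
  (λ x → trans (cong to (trans (cong (_∙ from x) (back _)) (identityˡ _))) (forth x))
  (λ x → trans (cong to (trans (cong (from x ∙_) (back _)) (identityʳ _))) (forth x))
  (λ x → cong to (trans (cong (_∙ from x) (back _)) (inverseˡ _)))
  (λ x → cong to (trans (cong (from x ∙_) (back _)) (inverseʳ _)))
  where open Inverse φ using (to; from) renaming (strictlyInverseˡ to forth; strictlyInverseʳ to back)
        open IsGroup isG using (assoc; identityˡ; identityʳ; inverseˡ; inverseʳ)

≟-via : ∀ {A : Set} {n} → A ↔ Fin n → (a b : A) → Dec (a ≡ b)
≟-via φ a b = map′ (λ eq → trans (sym (back a)) (trans (cong from eq) (back b)))
                   (cong to) (to a ≟ᶠ to b)
  where open Inverse φ renaming (strictlyInverseʳ to back)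

∈-tabulate : ∀ {n} (f : Fin n → Bool) {i} → i ∈ tabulate f ↔ T (f i)
∈-tabulate f {i} = mk↔ₛ′
  (λ i∈ → Equivalence.from T-≡ (trans (sym (lookup∘tabulate f i)) ([]=⇒lookup i∈)))
  (λ t → lookup⇒[]= i (tabulate f) (trans (lookup∘tabulate f i) (Equivalence.to T-≡ t)))
  (λ t → T-irrelevant _ t)
  (λ i∈ → []=-irrelevant _ i∈)

module Cyclic (n : ℕ) where
  N : ℕ
  N = suc n

  infixl 6 _⊕_
  _⊕_ : Fin N → Fin N → Fin N
  a ⊕ b = fromℕ< (m%n<n (toℕ a + toℕ b) N)

  ⊖_ : Fin N → Fin N
  ⊖ a = fromℕ< (m%n<n (N ∸ toℕ a) N)

  toℕ-⊕ : ∀ a b → toℕ (a ⊕ b) ≡ (toℕ a + toℕ b) % N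
  toℕ-⊕ a b = toℕ-fromℕ< (m%n<n (toℕ a + toℕ b) N)

  toℕ-⊖ : ∀ a → toℕ (⊖ a) ≡ (N ∸ toℕ a) % N
  toℕ-⊖ a = toℕ-fromℕ< (m%n<n (N ∸ toℕ a) N)

  %-absorbˡ : ∀ x y → (x % N + y) % N ≡ (x + y) % N
  %-absorbˡ x y = trans (%-distribˡ-+ (x % N) y N)
    (trans (cong (λ z → (z + y % N) % N) (m%n%n≡m%n x N)) (sym (%-distribˡ-+ x y N)))

  %-absorbʳ : ∀ x y → (x + y % N) % N ≡ (x + y) % N
  %-absorbʳ x y = trans (cong (_% N) (+-comm x (y % N)))
    (trans (%-absorbˡ y x) (cong (_% N) (+-comm y x)))

  toℕ-% : ∀ (a : Fin N) → toℕ a % N ≡ toℕ a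
  toℕ-% a = m<n⇒m%n≡m (toℕ<n a)

  ⊕-assoc : ∀ a b c → (a ⊕ b) ⊕ c ≡ a ⊕ (b ⊕ c)
  ⊕-assoc a b c = toℕ-injective (begin
      toℕ ((a ⊕ b) ⊕ c)                ≡⟨ toℕ-⊕ (a ⊕ b) c ⟩
      (toℕ (a ⊕ b) + toℕ c) % N        ≡⟨ cong (λ z → (z + toℕ c) % N) (toℕ-⊕ a b) ⟩
      ((toℕ a + toℕ b) % N + toℕ c) % N ≡⟨ %-absorbˡ (toℕ a + toℕ b) (toℕ c) ⟩
      (toℕ a + toℕ b + toℕ c) % N       ≡⟨ cong (_% N) (+-assoc (toℕ a) (toℕ b) (toℕ c)) ⟩
      (toℕ a + (toℕ b + toℕ c)) % N     ≡⟨ %-absorbʳ (toℕ a) (toℕ b + toℕ c) ⟨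
      (toℕ a + (toℕ b + toℕ c) % N) % N ≡⟨ cong (λ z → (toℕ a + z) % N) (toℕ-⊕ b c) ⟨
      (toℕ a + toℕ (b ⊕ c)) % N        ≡⟨ toℕ-⊕ a (b ⊕ c) ⟨
      toℕ (a ⊕ (b ⊕ c))                ∎)
    where open ≡-Reasoning

  ⊕-identityˡ : ∀ a → Fin.zero ⊕ a ≡ a
  ⊕-identityˡ a = toℕ-injective (trans (toℕ-⊕ Fin.zero a) (toℕ-% a))

  ⊕-identityʳ : ∀ a → a ⊕ Fin.zero ≡ a
  ⊕-identityʳ a = toℕ-injective (trans (toℕ-⊕ a Fin.zero)
    (trans (cong (_% N) (+-identityʳ (toℕ a))) (toℕ-% a)))

  toℕ≤N : ∀ (a : Fin N) → toℕ a ≤ N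
  toℕ≤N a = <⇒≤ (toℕ<n a)

  ⊖-inverseˡ : ∀ a → ⊖ a ⊕ a ≡ Fin.zero
  ⊖-inverseˡ a = toℕ-injective (begin
    toℕ (⊖ a ⊕ a)                ≡⟨ toℕ-⊕ (⊖ a) a ⟩
    (toℕ (⊖ a) + toℕ a) % N      ≡⟨ cong (λ z → (z + toℕ a) % N) (toℕ-⊖ a) ⟩
    ((N ∸ toℕ a) % N + toℕ a) % N ≡⟨ %-absorbˡ (N ∸ toℕ a) (toℕ a) ⟩
    (N ∸ toℕ a + toℕ a) % N       ≡⟨ cong (_% N) (m∸n+n≡m (toℕ≤N a)) ⟩
    N % N                         ≡⟨ n%n≡0 N ⟩
    0                             ∎)
    where open ≡-Reasoning

  ⊖-inverseʳ : ∀ a → a ⊕ ⊖ a ≡ Fin.zero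
  ⊖-inverseʳ a = toℕ-injective (begin
    toℕ (a ⊕ ⊖ a)                ≡⟨ toℕ-⊕ a (⊖ a) ⟩
    (toℕ a + toℕ (⊖ a)) % N      ≡⟨ cong (λ z → (toℕ a + z) % N) (toℕ-⊖ a) ⟩
    (toℕ a + (N ∸ toℕ a) % N) % N ≡⟨ %-absorbʳ (toℕ a) (N ∸ toℕ a) ⟩
    (toℕ a + (N ∸ toℕ a)) % N     ≡⟨ cong (_% N) (m+[n∸m]≡n (toℕ≤N a)) ⟩
    N % N                         ≡⟨ n%n≡0 N ⟩
    0                             ∎)
    where open ≡-Reasoning

  isGroup : IsGroup _≡_ _⊕_ Fin.zero ⊖_
  isGroup = isGroup-≡ _⊕_ Fin.zero ⊖_ ⊕-assoc ⊕-identityˡ ⊕-identityʳ ⊖-inverseˡ ⊖-inverseʳ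

pattern one = Fin.suc Fin.zero

module Shift (m : ℕ) where
  open Cyclic (suc m) using (_⊕_; isGroup)
  open GroupProperties (groupOf isGroup) using (∙-cancelʳ; identityʳ-unique)

  shift : Fin (suc (suc m)) → Fin (suc (suc m))
  shift c = c ⊕ one

  shift-injective : ∀ c d → shift c ≡ shift d → c ≡ d
  shift-injective c d = ∙-cancelʳ (one) c d

  shift-no-fixed-point : ∀ c → shift c ≢ c
  shift-no-fixed-point c eq with identityʳ-unique c (one) eq
  ... | ()

data GeneratedBy {A : Set} (_∙_ : A → A → A) (e : A) (conn : A → Bool) : A → Set where
  none : GeneratedBy _∙_ e conn e
  more : ∀ {g x} → GeneratedBy _∙_ e conn g → T (conn x) → GeneratedBy _∙_ e conn (g ∙ x)

ProperColouring : ∀ {A : Set} (_∙_ : A → A → A) (conn : A → Bool) {k} → (A → Fin k) → Set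
ProperColouring _∙_ conn c = ∀ g x → T (conn x) → c g ≢ c (g ∙ x)

record CayleyModel (r χ : ℕ) : Set₁ where
  field
    Carrier     : Set
    order       : ℕ
    enumeration : Carrier ↔ Fin order
    _∙_         : Carrier → Carrier → Carrier
    ε           : Carrier
    _⁻¹         : Carrier → Carrier
    isGroup     : IsGroup _≡_ _∙_ ε _⁻¹
    conn        : Carrier → Bool
    generates   : ∀ g → GeneratedBy _∙_ ε conn g
    symmetric   : ∀ x → T (conn x) → T (conn (x ⁻¹))
    no-unit     : ¬ T (conn ε)
    degree      : Σ Carrier (T ∘ conn) ↔ Fin r
    colour      : Carrier → Fin χ
    proper      : ProperColouring _∙_ conn colour
    no-fewer    : ∀ k → k < χ → (c : Carrier → Fin k) → ¬ ProperColouring _∙_ conn c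

nonzero : ∀ {N} → Fin N → Bool
nonzero Fin.zero    = false
nonzero (Fin.suc _) = true

nonzero-intro : ∀ {N} (x : Fin (suc N)) → x ≢ Fin.zero → T (nonzero x)
nonzero-intro Fin.zero    x≢0 = x≢0 refl
nonzero-intro (Fin.suc _) _   = _

nonzero-elim : ∀ {N} (x : Fin (suc N)) → T (nonzero x) → x ≢ Fin.zero
nonzero-elim (Fin.suc _) _ ()

-- The complete graph K_{n+1} = Cay(ℤ_{n+1}, ℤ_{n+1} ∖ {0}): n-regular,
-- properly coloured by the identity, and no k < n+1 colours suffice
-- because by pigeonhole two (necessarily adjacent) vertices share a colour.
complete : ∀ n → CayleyModel n (suc n)
complete n = record
  { Carrier = Fin (suc n) ; order = suc n ; enumeration = ↔-refl
  ; _∙_ = _⊕_ ; ε = Fin.zero ; _⁻¹ = ⊖_ ; isGroup = isGroup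
  ; conn = nonzero
  ; generates = generates
  ; symmetric = λ x t → nonzero-intro (⊖ x) (nonzero-elim x t ∘ inverse-zero x)
  ; no-unit = λ ()
  ; degree = degree
  ; colour = id
  ; proper = λ g x t eq → nonzero-elim x t (identityʳ-unique g x (sym eq))
  ; no-fewer = no-fewer }
  where
  open Cyclic n
  open GroupProperties (groupOf isGroup)
    using (identityʳ-unique; ε⁻¹≈ε; ⁻¹-injective; \\-leftDividesˡ)

  inverse-zero : ∀ x → ⊖ x ≡ Fin.zero → x ≡ Fin.zero
  inverse-zero x eq = ⁻¹-injective (trans eq (sym ε⁻¹≈ε))

  generates : ∀ g → GeneratedBy _⊕_ Fin.zero nonzero g
  generates Fin.zero    = none
  generates (Fin.suc j) = subst (GeneratedBy _⊕_ Fin.zero nonzero) (⊕-identityˡ (Fin.suc j))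
                                (more {x = Fin.suc j} none _)

  degree : Σ (Fin (suc n)) (T ∘ nonzero) ↔ Fin n
  degree = mk↔ₛ′ (λ { (Fin.zero , ()) ; (Fin.suc i , _) → i }) (λ i → Fin.suc i , _)
                 (λ _ → refl) (λ { (Fin.zero , ()) ; (Fin.suc i , _) → refl })

  -- Vertices i < j of the same colour are adjacent via x = -i + j ≠ 0.
  no-fewer : ∀ k → k < suc n → (c : Fin (suc n) → Fin k) →
             ¬ ProperColouring _⊕_ nonzero c
  no-fewer k k<N c proper-c with pigeonhole k<N c
  ... | i , j , i<j , ci≡cj =
    proper-c i (⊖ i ⊕ j) (nonzero-intro _ step≢0) (trans ci≡cj (cong c (sym (\\-leftDividesˡ i j))))
    where
    step≢0 : ⊖ i ⊕ j ≢ Fin.zero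
    step≢0 eq = <⇒≢ i<j (sym (begin
      j                ≡⟨ \\-leftDividesˡ i j ⟨
      i ⊕ (⊖ i ⊕ j)    ≡⟨ cong (i ⊕_) eq ⟩
      i ⊕ Fin.zero     ≡⟨ ⊕-identityʳ i ⟩
      i                ∎))
      where open ≡-Reasoning

module Prism {r m} (M : CayleyModel r (suc (suc m))) where
  open CayleyModel M
  open GroupProperties (groupOf isGroup) using (ε⁻¹≈ε)
  open Shift m using (shift; shift-injective; shift-no-fixed-point)
  module ℤ₂ = Cyclic 1

  _≟_ : (a b : Carrier) → Dec (a ≡ b)
  _≟_ = ≟-via enumeration

  isUnit : Carrier → Bool
  isUnit a = ⌊ a ≟ ε ⌋

  unit-right : ∀ g {x} → T (isUnit x) → g ∙ x ≡ g
  unit-right g t = trans (cong (g ∙_) (toWitness t)) (IsGroup.identityʳ isGroup g)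

  conn′ : Carrier × Fin 2 → Bool
  conn′ (a , Fin.zero) = conn a
  conn′ (a , one)      = isUnit a

  _∙′_ : Carrier × Fin 2 → Carrier × Fin 2 → Carrier × Fin 2
  (a , b) ∙′ (c , d) = (a ∙ c , b ℤ₂.⊕ d)

  ε′ : Carrier × Fin 2
  ε′ = (ε , Fin.zero)

  _⁻¹′ : Carrier × Fin 2 → Carrier × Fin 2
  (a , b) ⁻¹′ = (a ⁻¹ , ℤ₂.⊖ b)

  isGroup′ : IsGroup _≡_ _∙′_ ε′ _⁻¹′
  isGroup′ = ×-isGroup isGroup ℤ₂.isGroup

  generates-layer₀ : ∀ {a} → GeneratedBy _∙_ ε conn a → GeneratedBy _∙′_ ε′ conn′ (a , Fin.zero)
  generates-layer₀ none               = none
  generates-layer₀ (more {x = x} p t) = more {x = (x , Fin.zero)} (generates-layer₀ p) t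

  generates′ : ∀ g → GeneratedBy _∙′_ ε′ conn′ g
  generates′ (a , Fin.zero) = generates-layer₀ (generates a)
  generates′ (a , one) =
    subst (GeneratedBy _∙′_ ε′ conn′) (cong (_, one) (IsGroup.identityʳ isGroup a))
          (more {x = (ε , one)} (generates-layer₀ (generates a)) (fromWitness refl))

  symmetric′ : ∀ x → T (conn′ x) → T (conn′ (x ⁻¹′))
  symmetric′ (x , Fin.zero) t = symmetric x t
  symmetric′ (x , one)      t = fromWitness (trans (cong _⁻¹ (toWitness t)) ε⁻¹≈ε)

  degree′ : Σ (Carrier × Fin 2) (T ∘ conn′) ↔ Fin (suc r)
  degree′ = mk↔ₛ′ to from to-from from-to
    where
    open Inverse degree using () renaming
      (to to index; from to element; strictlyInverseˡ to index-element; strictlyInverseʳ to element-index)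
    to : Σ (Carrier × Fin 2) (T ∘ conn′) → Fin (suc r)
    to ((a , Fin.zero) , t) = Fin.suc (index (a , t))
    to ((a , one)      , t) = Fin.zero
    from : Fin (suc r) → Σ (Carrier × Fin 2) (T ∘ conn′)
    from Fin.zero    = (ε , one) , fromWitness refl
    from (Fin.suc i) = (proj₁ (element i) , Fin.zero) , proj₂ (element i)
    to-from : ∀ i → to (from i) ≡ i
    to-from Fin.zero    = refl
    to-from (Fin.suc i) = cong Fin.suc (index-element i)
    from-to : ∀ p → from (to p) ≡ p
    from-to ((a , Fin.zero) , t) =
      cong (λ (x , s) → ((x , Fin.zero) , s)) (element-index (a , t))
    from-to ((a , one) , t) with toWitness t
    ... | refl = cong ((ε , one) ,_) (T-irrelevant _ t)

  colour′ : Carrier × Fin 2 → Fin (suc (suc m))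
  colour′ (a , Fin.zero) = colour a
  colour′ (a , one)      = shift (colour a)

  proper′ : ProperColouring _∙′_ conn′ colour′
  proper′ (g , Fin.zero) (x , Fin.zero) t eq = proper g x t eq
  proper′ (g , one)      (x , Fin.zero) t eq = proper g x t (shift-injective _ _ eq)
  proper′ (g , Fin.zero) (x , one)      t eq =
    shift-no-fixed-point (colour g) (sym (trans eq (cong (shift ∘ colour) (unit-right g t))))
  proper′ (g , one)      (x , one)      t eq =
    shift-no-fixed-point (colour g) (trans eq (cong colour (unit-right g t)))

  no-fewer′ : ∀ k → k < suc (suc m) → (c : Carrier × Fin 2 → Fin k) →
              ¬ ProperColouring _∙′_ conn′ c
  no-fewer′ k k<χ c proper-c =
    no-fewer k k<χ (λ a → c (a , Fin.zero)) (λ g x t → proper-c (g , Fin.zero) (x , Fin.zero) t)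

  prism : CayleyModel (suc r) (suc (suc m))
  prism = record
    { Carrier = Carrier × Fin 2 ; order = order * 2
    ; enumeration = ↔-trans (enumeration ×-↔ ↔-refl) (↔-sym *↔×)
    ; _∙_ = _∙′_ ; ε = ε′ ; _⁻¹ = _⁻¹′ ; isGroup = isGroup′
    ; conn = conn′ ; generates = generates′ ; symmetric = symmetric′ ; no-unit = no-unit
    ; degree = degree′ ; colour = colour′ ; proper = proper′ ; no-fewer = no-fewer′ }

iterated-prism : ∀ m k → CayleyModel (k + suc m) (suc (suc m))
iterated-prism m zero    = complete (suc m)
iterated-prism m (suc k) = Prism.prism (iterated-prism m k)

neighbourhood↔connection : (Γ : FiniteGroup) (X : Subset (FiniteGroup.order Γ))
  (v : Fin (FiniteGroup.order Γ)) →
  Neighbourhood (CayAdj Γ X) v ↔ Σ (Fin (FiniteGroup.order Γ)) (λ x → x ∈ X)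
neighbourhood↔connection Γ X v = mk↔ₛ′
  (λ (_ , x , x∈X , _) → x , x∈X)
  (λ (x , x∈X) → FiniteGroup._∙_ Γ v x , x , x∈X , refl)
  (λ _ → refl)
  (λ { (_ , x , x∈X , refl) → refl })

-- A Cayley model, transported along its enumeration to a group on Fin n,
-- gives an honest Cayley graph with the same degree and chromatic number.
module Realise {r χ} (M : CayleyModel r χ) where
  open CayleyModel M
  open Inverse enumeration using (to; from)
    renaming (strictlyInverseˡ to to-from; strictlyInverseʳ to from-to)

  Γ : FiniteGroup
  Γ = record
    { order = order ; _∙_ = λ i j → to (from i ∙ from j) ; ε = to ε ; _⁻¹ = λ i → to (from i ⁻¹)
    ; isGroup = transport-isGroup enumeration isGroup }

  open FiniteGroup Γ using () renaming (_∙_ to _·_)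

  X : Subset order
  X = tabulate (conn ∘ from)

  X↔conn : ∀ {i} → i ∈ X ↔ T (conn (from i))
  X↔conn = ∈-tabulate (conn ∘ from)

  to-∈X : ∀ {a} → T (conn a) → to a ∈ X
  to-∈X {a} t = Inverse.from X↔conn (subst (T ∘ conn) (sym (from-to a)) t)

  to-∙ : ∀ a b → to (a ∙ b) ≡ to a · to b
  to-∙ a b = cong to (sym (cong₂ _∙_ (from-to a) (from-to b)))

  to-generated : ∀ {g} → GeneratedBy _∙_ ε conn g → Generated Γ X (to g)
  to-generated none                = gen-ε
  to-generated (more {g} {x} p t) =
    subst (Generated Γ X) (sym (to-∙ g x)) (gen-∙ (to-generated p) (to-∈X t))

  isCayleySet : IsCayleySet Γ X
  isCayleySet = record
    { generates = λ i → subst (Generated Γ X) (to-from i)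
                              (to-generated (generates (from i)))
    ; symmetric = λ x x∈X → to-∈X (symmetric (from x) (Inverse.to X↔conn x∈X))
    ; no-unit   = λ ε∈X → no-unit (subst (T ∘ conn) (from-to ε) (Inverse.to X↔conn ε∈X)) }

  regular : IsRegular (CayAdj Γ X) r
  regular v = ↔-trans (neighbourhood↔connection Γ X v)
                      (↔-trans (Σ-↔ (↔-sym enumeration) X↔conn) degree)

  colourable : Colourable (CayAdj Γ X) χ
  colourable = colour ∘ from , λ v w (x , x∈X , vx≡w) →
    subst (λ u → colour (from v) ≢ colour u) (trans (sym (from-to _)) (cong from vx≡w))
          (proper (from v) (from x) (Inverse.to X↔conn x∈X))

  chromatic : HasChromaticNumber (CayAdj Γ X) χ
  chromatic = colourable , λ k k<χ (c , proper-c) →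
    no-fewer k k<χ (c ∘ to)
      (λ g x t → proper-c (to g) (to (g ∙ x)) (to x , to-∈X t , sym (to-∙ g x)))

theorem1 : (r χ : ℕ) → 2 ≤ χ → χ ≤ suc r →
    Σ FiniteGroup (λ Γ → Σ (Subset (FiniteGroup.order Γ)) (λ X →
    IsCayleySet Γ X × IsRegular (CayAdj Γ X) r × HasChromaticNumber (CayAdj Γ X) χ))
theorem1 r (suc (suc m)) (s≤s (s≤s _)) χ≤r+1 =
  Γ , X , isCayleySet , regular , chromatic
  where
  model : CayleyModel r (suc (suc m))
  model = subst (λ d → CayleyModel d (suc (suc m))) (m∸n+n≡m (≤-pred χ≤r+1))
                (iterated-prism m (r ∸ suc m))
  open Realise model
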